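{- (i) If $\mathfrak E$ is a regular Esakia space, then $\sim_\infty$ is the identity relation on $\mathfrak E$, i.e. $\mathfrak E=\mathfrak E/{\sim_\infty}$. (ii) If $\mathfrak F$ is a finite poset with $\mathfrak F=\mathfrak F/{\sim_\infty}$ (i.e. $\sim_\infty$ is the identity on $\mathfrak F$), then $\mathfrak F$ is regular. In particular, a finite Heyting algebra is regular if and only if $\sim_\infty$ is the identity relation on its dual poset.
   Context: An Esakia space $\mathfrak E$ is regular if the Heyting algebra $H_{\mathfrak E}$ of its clopen upsets is generated (as a Heyting algebra) by its regular elements $U=\neg\neg U$; a finite poset is regular if its Heyting algebra of upsets is so generated; the dual poset of a finite Heyting algebra is its poset of prime filters. A poset is compact if every element lies below a maximal element (the order reduct of any Esakia space is compact). For $x$ in a compact poset, $M(x)$ is the set of maximal elements above $x$. Define: $x\sim_0 y$ iff $M(x)=M(y)$; $x\sim_{n+1}y$ iff $\{[z]_n : z\ge x\}=\{[z]_n: z\ge y\}$ where $[z]_n$ is the $\sim_n$-class of $z$; and $\sim_\infty=\bigcap_{n<\omega}\sim_n$. -}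

module Defs where

open import Level using (Level; _⊔_; 0ℓ; Lift) renaming (suc to lsuc)
open import Data.Nat using (ℕ; zero; suc)
open import Data.Fin using (Fin)
open import Data.Empty using (⊥)
open import Data.Unit using (⊤)
open import Data.Product using (Σ; ∃; _×_; _,_; proj₁)
open import Data.Sum using (_⊎_)
open import Data.List using (List)
open import Data.List.Relation.Unary.Any using (Any)
open import Relation.Nullary using (¬_)
open import Relation.Unary using (Pred; _∈_; _∉_; _∩_; _∪_; ∁; _≐_; _⊆_)
open import Relation.Binary using (Rel; IsPartialOrder)
open import Relation.Binary.PropositionalEquality using (_≡_)
open import Relation.Binary.Lattice.Bundles using (HeytingAlgebra)

module _ {a r : Level} {X : Set a} (_≤_ : Rel X r) where

  -- m is maximal (for a partial order this is: m ≤ y implies y = m)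
  Maximal : X → Set (a ⊔ r)
  Maximal m = ∀ y → m ≤ y → y ≤ m

  CompactPoset : Set (a ⊔ r)
  CompactPoset = ∀ x → ∃ λ m → Maximal m × x ≤ m

  -- x ∼ₙ y.  n = 0 : M(x) = M(y);
  -- n+1 : {[z]ₙ : z ≥ x} = {[z]ₙ : z ≥ y}
  Sim : ℕ → Rel X (a ⊔ r)
  Sim zero    x y = ∀ m → Maximal m → (x ≤ m → y ≤ m) × (y ≤ m → x ≤ m)
  Sim (suc n) x y =
    (∀ z → x ≤ z → ∃ λ w → y ≤ w × Sim n z w) ×
    (∀ w → y ≤ w → ∃ λ z → x ≤ z × Sim n z w)

  SimInf : Rel X (a ⊔ r)
  SimInf x y = ∀ n → Sim n x y

module _ {X : Set} (_≤_ : Rel X 0ℓ) where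

  UpSet : Pred X 0ℓ → Set
  UpSet U = ∀ {x y} → x ≤ y → U x → U y

  ↓_ : Pred X 0ℓ → Pred X 0ℓ
  (↓ U) x = ∃ λ y → x ≤ y × U y

  _⇒U_ : Pred X 0ℓ → Pred X 0ℓ → Pred X 0ℓ
  A ⇒U B = ∁ (↓ (A ∩ ∁ B))

  ¬U : Pred X 0ℓ → Pred X 0ℓ
  ¬U U = ∁ (↓ U)

  -- the Heyting subalgebra (of the Heyting algebra of upsets belonging to
  -- the family InH) generated by its regular elements U = ¬¬U
  data GenReg (InH : Pred X 0ℓ → Set₁) : Pred X 0ℓ → Set₁ where
    reg  : ∀ {U} → InH U → U ≐ ¬U (¬U U) → GenReg InH U
    top  : GenReg InH (λ _ → ⊤)
    bot  : GenReg InH (λ _ → ⊥)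
    meet : ∀ {A B} → GenReg InH A → GenReg InH B → GenReg InH (A ∩ B)
    join : ∀ {A B} → GenReg InH A → GenReg InH B → GenReg InH (A ∪ B)
    imp  : ∀ {A B} → GenReg InH A → GenReg InH B → GenReg InH (A ⇒U B)
    resp : ∀ {A B} → A ≐ B → GenReg InH A → GenReg InH B

record Topology (X : Set) : Set₂ where
  field
    IsOpen   : Pred X 0ℓ → Set₁
    open-≐   : ∀ {U V} → U ≐ V → IsOpen U → IsOpen V
    open-X   : IsOpen (λ _ → ⊤)
    open-∩   : ∀ {U V} → IsOpen U → IsOpen V → IsOpen (U ∩ V)
    open-⋃   : {I : Set} (U : I → Pred X 0ℓ) → (∀ i → IsOpen (U i)) →
               IsOpen (λ x → ∃ λ i → U i x)

  Clopen : Pred X 0ℓ → Set₁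
  Clopen U = IsOpen U × IsOpen (∁ U)

  Compact : Set₂
  Compact = {I : Set₁} (U : I → Pred X 0ℓ) → (∀ i → IsOpen (U i)) →
            (∀ x → ∃ λ i → U i x) →
            ∃ λ (is : List I) → ∀ x → Any (λ i → U i x) is

record EsakiaSpace : Set₃ where
  field
    Carrier        : Set
    _≤_            : Rel Carrier 0ℓ
    isPartialOrder : IsPartialOrder _≡_ _≤_
    topology       : Topology Carrier
  open Topology topology public
  field
    compact   : Compact
    priestley : ∀ x y → ¬ (x ≤ y) →
                ∃ λ U → Clopen U × UpSet _≤_ U × U x × ¬ U y
    esakia    : ∀ U → Clopen U → Clopen (↓_ _≤_ U)

  InH : Pred Carrier 0ℓ → Set₁
  InH U = Clopen U × UpSet _≤_ U

RegularEsakia : EsakiaSpace → Set₁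
RegularEsakia E = ∀ U → InH U → GenReg _≤_ InH U
  where open EsakiaSpace E

record FinitePoset : Set₁ where
  field
    size           : ℕ
    _≤_            : Rel (Fin size) 0ℓ
    isPartialOrder : IsPartialOrder _≡_ _≤_

  InHF : Pred (Fin size) 0ℓ → Set₁
  InHF U = Lift (lsuc 0ℓ) (UpSet _≤_ U)

RegularFinitePoset : FinitePoset → Set₁
RegularFinitePoset F = ∀ U → UpSet _≤_ U → GenReg _≤_ InHF U
  where open FinitePoset F

module _ (H : HeytingAlgebra 0ℓ 0ℓ 0ℓ) where
  open HeytingAlgebra H

  FiniteHA : Set
  FiniteHA = ∃ λ n → ∃ λ (f : Fin n → Carrier) → ∀ a → ∃ λ i → f i ≈ a

  ¬H : Carrier → Carrier
  ¬H a = a ⇨ HeytingAlgebra.⊥ H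

  data GenRegHA : Carrier → Set where
    reg  : ∀ {a} → a ≈ ¬H (¬H a) → GenRegHA a
    top  : GenRegHA (HeytingAlgebra.⊤ H)
    bot  : GenRegHA (HeytingAlgebra.⊥ H)
    meet : ∀ {a b} → GenRegHA a → GenRegHA b → GenRegHA (a ∧ b)
    join : ∀ {a b} → GenRegHA a → GenRegHA b → GenRegHA (a ∨ b)
    imp  : ∀ {a b} → GenRegHA a → GenRegHA b → GenRegHA (a ⇨ b)
    resp : ∀ {a b} → a ≈ b → GenRegHA a → GenRegHA b

  RegularHA : Set
  RegularHA = ∀ a → GenRegHA a

  record IsPrimeFilter (F : Pred Carrier 0ℓ) : Set where
    field
      top-in : F (HeytingAlgebra.⊤ H)
      up     : ∀ {a b} → a ≤ b → F a → F b
      ∧-cl   : ∀ {a b} → F a → F b → F (a ∧ b)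
      proper : ¬ F (HeytingAlgebra.⊥ H)
      prime  : ∀ {a b} → F (a ∨ b) → F a ⊎ F b

  -- dual poset: prime filters ordered by inclusion
  PrimeFilter : Set₁
  PrimeFilter = Σ (Pred Carrier 0ℓ) IsPrimeFilter

  _⊑_ : Rel PrimeFilter 0ℓ
  F ⊑ G = proj₁ F ⊆ proj₁ G

{-# OPTIONS --safe #-}
-- Call a predicate finitely saturated if it is closed under some ∼ₙ. On a compact poset
-- ∼ₙ₊₁ ⊆ ∼ₙ, regular upsets are ∼₀-saturated, ∩ and ∪ keep the stage and ⇒ raises it by one;
-- so everything generated by regular elements is ∼∞-closed, and Priestley separation
-- (resp. separation of prime filters by elements) makes ∼∞ the identity.
-- Conversely, write x ≤Φ y when every generated element containing x contains y. In the
-- finite cases, if x ≤Φ y then x ≤ z for some z ≈Φ y: refute (⋀ of the generated elements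
-- containing y) ⇒ (⋁ of those omitting y) above x. Since ↓m is the complement of a regular
-- element for each maximal m, ≈Φ ⊆ ∼ₙ for every n. Hence if ∼∞ is the identity, ≤Φ is the
-- order itself, so generated elements separate points, and by finiteness every upset
-- (every element of H) is a finite join of generated ones.
module Submission where

open import Defs
open import Level using (Level; _⊔_; 0ℓ; lift; lower)
open import Data.Nat using (ℕ; zero; suc; z≤n; s≤s) renaming (_≤_ to _≤ℕ_; _⊔_ to _⊔ℕ_)
open import Data.Nat.Properties using (m≤m⊔n; m≤n⊔m)
open import Data.Fin using (Fin; zero; suc)
open import Data.Product using (Σ; ∃; _×_; _,_; proj₁; proj₂; swap)
open import Data.Sum using (_⊎_; inj₁; inj₂; [_,_]′)
open import Data.Empty using (⊥; ⊥-elim)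
open import Data.Unit using (⊤; tt)
open import Data.List using ([]; _∷_)
open import Data.List.Relation.Unary.All as All using (All; []; _∷_)
open import Function using (_∘_)
open import Relation.Nullary using (¬_; yes; no)
open import Relation.Unary using (Pred; _≐_; _⊆_; ∁; _∩_; _∪_)
open import Relation.Binary using (Rel; IsPartialOrder)
open import Relation.Binary.PropositionalEquality using (_≡_)
open import Relation.Binary.Lattice.Bundles using (HeytingAlgebra; BoundedMeetSemilattice)
open import Axiom.ExcludedMiddle using (ExcludedMiddle)
open import Axiom.DoubleNegationElimination using (DoubleNegationElimination; em⇒dne)

module SimProperties {a r : Level} {X : Set a} (_≼_ : Rel X r)
  (≼-refl : ∀ {x} → x ≼ x) (≼-trans : ∀ {x y z} → x ≼ y → y ≼ z → x ≼ z) where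

  Sim-sym : ∀ n {x y} → Sim _≼_ n x y → Sim _≼_ n y x
  Sim-sym zero s m max = swap (s m max)
  Sim-sym (suc n) (forth , back) =
    (λ w yw → let (z , xz , s) = back w yw in z , xz , Sim-sym n s) ,
    (λ z xz → let (w , yw , s) = forth z xz in w , yw , Sim-sym n s)

  SimInf-sym : ∀ {x y} → SimInf _≼_ x y → SimInf _≼_ y x
  SimInf-sym s n = Sim-sym n (s n)

  Sim-suc-map : ∀ {m n} → (∀ {z w} → Sim _≼_ m z w → Sim _≼_ n z w) →
                ∀ {x y} → Sim _≼_ (suc m) x y → Sim _≼_ (suc n) x y
  Sim-suc-map f (forth , back) =
    (λ z xz → let (w , yw , s) = forth z xz in w , yw , f s) ,
    (λ w yw → let (z , xz , s) = back w yw in z , xz , f s)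

  Saturated : ∀ {ℓ} → ℕ → Pred X ℓ → Set (a ⊔ r ⊔ ℓ)
  Saturated n A = ∀ {x y} → Sim _≼_ n x y → A x → A y

  FinitelySaturated : ∀ {ℓ} → Pred X ℓ → Set (a ⊔ r ⊔ ℓ)
  FinitelySaturated A = ∃ λ n → Saturated n A

  FinitelySaturated⇒SimInf-closed : ∀ {ℓ} {A : Pred X ℓ} → FinitelySaturated A →
                                    ∀ {x y} → SimInf _≼_ x y → A x → A y
  FinitelySaturated⇒SimInf-closed (n , sat) s = sat (s n)

  FinitelySaturated-resp : ∀ {ℓ ℓ'} {A : Pred X ℓ} {B : Pred X ℓ'} →
                           A ≐ B → FinitelySaturated A → FinitelySaturated B
  FinitelySaturated-resp (A⊆B , B⊆A) (n , sat) = n , λ s → A⊆B ∘ sat s ∘ B⊆A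

  FinitelySaturated-⊤ : ∀ {ℓ} {A : Pred X ℓ} → (∀ x → A x) → FinitelySaturated A
  FinitelySaturated-⊤ all = 0 , λ {_} {y} _ _ → all y

  FinitelySaturated-⊥ : ∀ {ℓ} {A : Pred X ℓ} → (∀ x → ¬ A x) → FinitelySaturated A
  FinitelySaturated-⊥ none = 0 , λ {x} _ Ax → ⊥-elim (none x Ax)

  -- ¬U and _⇒U_ of Defs, at arbitrary levels
  ∁↓ : ∀ {ℓ} → Pred X ℓ → Pred X (a ⊔ r ⊔ ℓ)
  ∁↓ A x = ¬ (∃ λ z → x ≼ z × A z)

  _⇛_ : ∀ {ℓ ℓ'} → Pred X ℓ → Pred X ℓ' → Pred X (a ⊔ r ⊔ ℓ ⊔ ℓ')
  A ⇛ B = ∁↓ (A ∩ ∁ B)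

  Saturated-⇛ : ∀ {ℓ ℓ' n} {A : Pred X ℓ} {B : Pred X ℓ'} →
                Saturated n A → Saturated n B → Saturated (suc n) (A ⇛ B)
  Saturated-⇛ {n = n} satA satB (_ , back) A⇛Bx (w , yw , Aw , ¬Bw) =
    let (z , xz , s) = back w yw in
    A⇛Bx (z , xz , satA (Sim-sym n s) Aw , ¬Bw ∘ satB s)

  module _ (compact : CompactPoset _≼_) where

    Sim-suc⇒Sim : ∀ n {x y} → Sim _≼_ (suc n) x y → Sim _≼_ n x y
    Sim-suc⇒Sim zero (forth , back) m max =
      (λ xm → let (w , yw , s) = forth m xm in ≼-trans yw (below-m w (Sim-sym 0 s))) ,
      (λ ym → let (z , xz , s) = back m ym in ≼-trans xz (below-m z s))
      where
        below-m : ∀ u → Sim _≼_ 0 u m → u ≼ m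
        below-m u s = let (m' , max' , um') = compact u in
                      ≼-trans um' (max m' (proj₁ (s m' max') um'))
    Sim-suc⇒Sim (suc n) = Sim-suc-map (Sim-suc⇒Sim n)

    Sim-antitone : ∀ {m n} → m ≤ℕ n → ∀ {x y} → Sim _≼_ n x y → Sim _≼_ m x y
    Sim-antitone {zero} {zero} _ s = s
    Sim-antitone {zero} {suc n} _ s = Sim-antitone {zero} {n} z≤n (Sim-suc⇒Sim n s)
    Sim-antitone {suc m} {suc n} (s≤s m≤n) = Sim-suc-map (Sim-antitone m≤n)

    Saturated-monotone : ∀ {ℓ m n} {A : Pred X ℓ} → m ≤ℕ n → Saturated m A → Saturated n A
    Saturated-monotone m≤n sat = sat ∘ Sim-antitone m≤n

    private
      combine : ∀ {ℓ ℓ' ℓ''} {A : Pred X ℓ} {B : Pred X ℓ'} {C : Pred X ℓ''} (k : ℕ → ℕ) →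
                (∀ {n} → Saturated n A → Saturated n B → Saturated (k n) C) →
                FinitelySaturated A → FinitelySaturated B → FinitelySaturated C
      combine k op (m , satA) (n , satB) =
        k (m ⊔ℕ n) ,
        op (Saturated-monotone (m≤m⊔n m n) satA) (Saturated-monotone (m≤n⊔m m n) satB)

    FinitelySaturated-∩ : ∀ {ℓ ℓ'} {A : Pred X ℓ} {B : Pred X ℓ'} →
                          FinitelySaturated A → FinitelySaturated B → FinitelySaturated (A ∩ B)
    FinitelySaturated-∩ = combine (λ n → n) λ satA satB s (Ax , Bx) → satA s Ax , satB s Bx

    FinitelySaturated-∪ : ∀ {ℓ ℓ'} {A : Pred X ℓ} {B : Pred X ℓ'} →
                          FinitelySaturated A → FinitelySaturated B → FinitelySaturated (A ∪ B)
    FinitelySaturated-∪ = combine (λ n → n) λ satA satB s → [ inj₁ ∘ satA s , inj₂ ∘ satB s ]′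

    FinitelySaturated-⇛ : ∀ {ℓ ℓ'} {A : Pred X ℓ} {B : Pred X ℓ'} →
                          FinitelySaturated A → FinitelySaturated B → FinitelySaturated (A ⇛ B)
    FinitelySaturated-⇛ = combine suc Saturated-⇛

    regular-upset-saturated : ∀ {ℓ} {A : Pred X ℓ} → (∀ {x y} → x ≼ y → A x → A y) →
                              ∁↓ (∁↓ A) ⊆ A → FinitelySaturated A
    regular-upset-saturated up regular = 0 , λ {x} s Ax → regular λ (z , yz , nothing-above) →
      let (m , max , zm) = compact z in
      nothing-above (m , zm , up (proj₂ (s m max) (≼-trans yz zm)) Ax)

module Separation {a r i p : Level} {X : Set a} (_≼_ : Rel X r)
  (≼-trans : ∀ {x y z} → x ≼ y → y ≼ z → x ≼ z)
  {I : Set i} (Φ : I → Pred X p) (Φ-upset : ∀ k {x y} → x ≼ y → Φ k x → Φ k y) where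

  -- Φ enumerates the elements of the subalgebra generated by the regular elements

  _≤Φ_ : Rel X (i ⊔ p)
  x ≤Φ y = ∀ k → Φ k x → Φ k y

  _≈Φ_ : Rel X (i ⊔ p)
  x ≈Φ y = x ≤Φ y × y ≤Φ x

  ≼⇒≤Φ : ∀ {x y} → x ≼ y → x ≤Φ y
  ≼⇒≤Φ xy k = Φ-upset k xy

  ≤Φ-trans : ∀ {x y z} → x ≤Φ y → y ≤Φ z → x ≤Φ z
  ≤Φ-trans xy yz k = yz k ∘ xy k

  module _
    (≤Φ-lift : ∀ {x y} → x ≤Φ y → ∃ λ z → x ≼ z × z ≈Φ y)
    (↓maximal-co-definable : ∀ m → Maximal _≼_ m →
       ∃ λ k → ∀ v → (v ≼ m → ¬ Φ k v) × (¬ Φ k v → v ≼ m))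
    where

    ≈Φ⇒Sim : ∀ n {x y} → x ≈Φ y → Sim _≼_ n x y
    ≈Φ⇒Sim zero (x≤y , y≤x) m max = below-m y≤x , below-m x≤y
      where
        below-m : ∀ {u v} → v ≤Φ u → u ≼ m → v ≼ m
        below-m {u} {v} v≤u um = let (k , ↓m≐∁Φk) = ↓maximal-co-definable m max in
          proj₂ (↓m≐∁Φk v) (proj₁ (↓m≐∁Φk u) um ∘ v≤u k)
    ≈Φ⇒Sim (suc n) (x≤y , y≤x) =
      (λ z xz → let (w , yw , w≈z) = ≤Φ-lift (≤Φ-trans y≤x (≼⇒≤Φ xz)) in
                w , yw , ≈Φ⇒Sim n (swap w≈z)) ,
      (λ w yw → let (z , xz , z≈w) = ≤Φ-lift (≤Φ-trans x≤y (≼⇒≤Φ yw)) in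
                z , xz , ≈Φ⇒Sim n z≈w)

    ≤Φ⇒≼ : (∀ {x y} → SimInf _≼_ x y → x ≼ y) → ∀ {x y} → x ≤Φ y → x ≼ y
    ≤Φ⇒≼ SimInf⇒≼ x≤y = let (z , xz , z≈y) = ≤Φ-lift x≤y in
      ≼-trans xz (SimInf⇒≼ λ n → ≈Φ⇒Sim n z≈y)

module EsakiaSpaceProperties (em : ∀ {ℓ} → ExcludedMiddle ℓ) (E : EsakiaSpace) where
  open EsakiaSpace E
  open IsPartialOrder isPartialOrder using (refl; trans; antisym)

  dne : ∀ {ℓ} → DoubleNegationElimination ℓ
  dne = em⇒dne em

  -- If no maximal point lies above x₀, the sets Open i cover the space, yet every finite
  -- subfamily misses some point above x₀; so compactness yields a maximal point above x₀.
  module _ (x₀ : Carrier) (no-maximal-above : ¬ (∃ λ m → Maximal _≤_ m × x₀ ≤ m)) where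

    Index : Set₁
    Index = Σ (Pred Carrier 0ℓ) λ U → InH U × (U x₀ ⊎ ⊤)

    Open : Index → Pred Carrier 0ℓ
    Open (U , _ , inj₁ _) = ∁ U
    Open (U , _ , inj₂ _) = ∁ U ∩ ↓_ _≤_ U

    Open-isOpen : ∀ i → IsOpen (Open i)
    Open-isOpen (U , (clopen , _) , inj₁ _) = proj₂ clopen
    Open-isOpen (U , (clopen , _) , inj₂ _) = open-∩ (proj₂ clopen) (proj₁ (esakia U clopen))

    not-maximal : ∀ {x} → x₀ ≤ x → ∃ λ y → x ≤ y × ¬ y ≤ x
    not-maximal {x} x₀≤x = dne λ maximal →
      no-maximal-above (x , (λ y xy → dne λ y≰x → maximal (y , xy , y≰x)) , x₀≤x)

    Open-cover : ∀ x → ∃ λ i → Open i x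
    Open-cover x with em {P = x₀ ≤ x}
    ... | no x₀≰x = let (U , clopen , up , Ux₀ , ¬Ux) = priestley x₀ x x₀≰x in
                    (U , (clopen , up) , inj₁ Ux₀) , ¬Ux
    ... | yes x₀≤x = let (y , xy , y≰x) = not-maximal x₀≤x
                         (U , clopen , up , Uy , ¬Ux) = priestley y x y≰x
                     in (U , (clopen , up) , inj₂ tt) , ¬Ux , (y , xy , Uy)

    Avoids : Index → Pred Carrier 0ℓ
    Avoids i y = ∀ z → y ≤ z → ¬ Open i z

    avoid-all : ∀ is → ∃ λ y → x₀ ≤ y × All (λ i → Avoids i y) is
    avoid-all [] = x₀ , refl , []
    avoid-all ((U , (_ , up) , inj₁ Ux₀) ∷ is) =
      let (y , x₀y , avoids) = avoid-all is in
      y , x₀y , (λ z yz ¬Uz → ¬Uz (up (trans x₀y yz) Ux₀)) ∷ avoids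
    avoid-all ((U , (_ , up) , inj₂ _) ∷ is) with avoid-all is
    ... | y , x₀y , avoids with em {P = (↓_ _≤_ U) y}
    ...   | yes (z , yz , Uz) =
            z , trans x₀y yz ,
            (λ w zw (¬Uw , _) → ¬Uw (up zw Uz)) ∷
            All.map (λ avoids-above-y w zw → avoids-above-y w (trans yz zw)) avoids
    ...   | no ¬↓Uy = y , x₀y , (λ z yz (_ , w , zw , Uw) → ¬↓Uy (w , trans yz zw , Uw)) ∷ avoids

  ≤-compact : CompactPoset _≤_
  ≤-compact x₀ = dne λ no-maximal-above →
    let (is , covered) = compact (Open x₀ no-maximal-above) (Open-isOpen x₀ no-maximal-above)
                                 (Open-cover x₀ no-maximal-above)
        (y , _ , avoids) = avoid-all x₀ no-maximal-above is
    in All.lookupWith (λ avoid → avoid _ refl) avoids (covered y)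

  open SimProperties _≤_ refl trans

  GenReg⇒FinitelySaturated : ∀ {U} → GenReg _≤_ InH U → FinitelySaturated U
  GenReg⇒FinitelySaturated (reg (_ , up) (_ , ¬¬U⊆U)) =
    regular-upset-saturated ≤-compact up ¬¬U⊆U
  GenReg⇒FinitelySaturated top = FinitelySaturated-⊤ _
  GenReg⇒FinitelySaturated bot = FinitelySaturated-⊥ λ _ ()
  GenReg⇒FinitelySaturated (meet A B) =
    FinitelySaturated-∩ ≤-compact (GenReg⇒FinitelySaturated A) (GenReg⇒FinitelySaturated B)
  GenReg⇒FinitelySaturated (join A B) =
    FinitelySaturated-∪ ≤-compact (GenReg⇒FinitelySaturated A) (GenReg⇒FinitelySaturated B)
  GenReg⇒FinitelySaturated (imp A B) =
    FinitelySaturated-⇛ ≤-compact (GenReg⇒FinitelySaturated A) (GenReg⇒FinitelySaturated B)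
  GenReg⇒FinitelySaturated (resp A≐B A) = FinitelySaturated-resp A≐B (GenReg⇒FinitelySaturated A)

  regular⇒SimInf⇒≡ : RegularEsakia E → ∀ x y → SimInf _≤_ x y → x ≡ y
  regular⇒SimInf⇒≡ regular x y s = antisym (SimInf⇒≤ s) (SimInf⇒≤ (SimInf-sym s))
    where
      SimInf⇒≤ : ∀ {x y} → SimInf _≤_ x y → x ≤ y
      SimInf⇒≤ {x} {y} s = dne λ x≰y →
        let (U , clopen , up , Ux , ¬Uy) = priestley x y x≰y
            U-saturated = GenReg⇒FinitelySaturated (regular U (clopen , up))
        in ¬Uy (FinitelySaturated⇒SimInf-closed U-saturated s Ux)

module GenRegProperties {X : Set} (_≤_ : Rel X 0ℓ)
  (≤-refl : ∀ {x} → x ≤ x) (≤-trans : ∀ {x y z} → x ≤ y → y ≤ z → x ≤ z)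
  {InH : Pred X 0ℓ → Set₁} where

  ¬U-upset : ∀ {A} → UpSet _≤_ (¬U _≤_ A)
  ¬U-upset xy ¬↓Ax (z , yz , Az) = ¬↓Ax (z , ≤-trans xy yz , Az)

  ¬U-regular : ∀ {A} → UpSet _≤_ A → ¬U _≤_ A ≐ ¬U _≤_ (¬U _≤_ (¬U _≤_ A))
  ¬U-regular up =
    (λ ¬↓Ax (z , xz , ¬¬Az) → ¬¬Az (z , ≤-refl , ¬U-upset xz ¬↓Ax)) ,
    (λ ¬¬¬Ax (z , xz , Az) → ¬¬¬Ax (z , xz , λ (w , zw , ¬↓Aw) → ¬↓Aw (w , ≤-refl , up zw Az)))

  GenReg-upset : (∀ {U} → InH U → UpSet _≤_ U) → ∀ {A} → GenReg _≤_ InH A → UpSet _≤_ A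
  GenReg-upset InH-upset (reg U _) = InH-upset U
  GenReg-upset InH-upset top _ _ = tt
  GenReg-upset InH-upset bot _ ()
  GenReg-upset InH-upset (meet A B) xy (Ax , Bx) =
    GenReg-upset InH-upset A xy Ax , GenReg-upset InH-upset B xy Bx
  GenReg-upset InH-upset (join A B) xy =
    [ inj₁ ∘ GenReg-upset InH-upset A xy , inj₂ ∘ GenReg-upset InH-upset B xy ]′
  GenReg-upset InH-upset (imp A B) = ¬U-upset
  GenReg-upset InH-upset (resp (A⊆B , B⊆A) A) xy = A⊆B ∘ GenReg-upset InH-upset A xy ∘ B⊆A

  GenReg-⋂ : ∀ n {P : Fin n → Pred X 0ℓ} → (∀ i → GenReg _≤_ InH (P i)) →
             GenReg _≤_ InH (λ x → ∀ i → P i x)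
  GenReg-⋂ zero _ = resp ((λ _ ()) , λ _ → tt) top
  GenReg-⋂ (suc n) P =
    resp ((λ { (Px , Psx) zero → Px ; (Px , Psx) (suc i) → Psx i }) , (λ Px → Px zero , Px ∘ suc))
         (meet (P zero) (GenReg-⋂ n (P ∘ suc)))

  GenReg-⋃ : ∀ n {P : Fin n → Pred X 0ℓ} → (∀ i → GenReg _≤_ InH (P i)) →
             GenReg _≤_ InH (λ x → ∃ λ i → P i x)
  GenReg-⋃ zero _ = resp ((λ ()) , λ ()) bot
  GenReg-⋃ (suc n) P =
    resp ([ (zero ,_) , (λ (i , Px) → suc i , Px) ]′ ,
          (λ { (zero , Px) → inj₁ Px ; (suc i , Px) → inj₂ (i , Px) }))
         (join (P zero) (GenReg-⋃ n (P ∘ suc)))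

module FinitePosetProperties (em : ∀ {ℓ} → ExcludedMiddle ℓ) (F : FinitePoset) where
  open FinitePoset F
  open IsPartialOrder isPartialOrder using (refl; trans; reflexive)
  open GenRegProperties _≤_ refl trans {InHF}

  dne : ∀ {ℓ} → DoubleNegationElimination ℓ
  dne = em⇒dne em

  Point : Set
  Point = Fin size

  Generated : Pred Point 0ℓ → Set₁
  Generated = GenReg _≤_ InHF

  Generated-upset : ∀ {A} → Generated A → UpSet _≤_ A
  Generated-upset = GenReg-upset lower

  open Separation _≤_ trans {I = Σ (Pred Point 0ℓ) Generated} proj₁ (Generated-upset ∘ proj₂)

  Separable : Point → Point → Set₁
  Separable u v = ∃ λ D → Generated D × D u × ¬ D v

  ¬Separable⇒≤Φ : ∀ {u v} → ¬ Separable u v → u ≤Φ v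
  ¬Separable⇒≤Φ ¬sep (D , D-gen) Du = dne λ ¬Dv → ¬sep (D , D-gen , Du , ¬Dv)

  record Containing (y i : Point) : Set₁ where
    field
      set       : Pred Point 0ℓ
      generated : Generated set
      has-y     : set y
      lacks-i   : Separable y i → ¬ set i

  record Omitting (y i : Point) : Set₁ where
    field
      set       : Pred Point 0ℓ
      generated : Generated set
      lacks-y   : ¬ set y
      has-i     : Separable i y → set i

  containing : ∀ y i → Containing y i
  containing y i with em {P = Separable y i}
  ... | yes (D , D-gen , Dy , ¬Di) =
    record { set = D ; generated = D-gen ; has-y = Dy ; lacks-i = λ _ → ¬Di }
  ... | no ¬sep = record { set = λ _ → ⊤ ; generated = top ; has-y = tt ; lacks-i = ⊥-elim ∘ ¬sep }

  omitting : ∀ y i → Omitting y i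
  omitting y i with em {P = Separable i y}
  ... | yes (D , D-gen , Di , ¬Dy) =
    record { set = D ; generated = D-gen ; lacks-y = ¬Dy ; has-i = λ _ → Di }
  ... | no ¬sep = record { set = λ _ → ⊥ ; generated = bot ; lacks-y = λ () ; has-i = ⊥-elim ∘ ¬sep }

  ≤Φ-lift : ∀ {x y} → x ≤Φ y → ∃ λ z → x ≤ z × z ≈Φ y
  ≤Φ-lift {x} {y} x≤Φy =
    let (z , xz , Az , ¬Bz) = dne (A⇒B-fails-at-y ∘ x≤Φy (_ , A⇒B-generated))
    in z , xz , ≤Φy ¬Bz , y≤Φ Az
    where
      module C i = Containing (containing y i)
      module O i = Omitting (omitting y i)

      A B : Pred Point 0ℓ
      A z = ∀ i → C.set i z
      B z = ∃ λ i → O.set i z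

      A⇒B-generated : Generated (_⇒U_ _≤_ A B)
      A⇒B-generated = imp (GenReg-⋂ size C.generated) (GenReg-⋃ size O.generated)

      A⇒B-fails-at-y : ¬ _⇒U_ _≤_ A B y
      A⇒B-fails-at-y A⇒B = A⇒B (y , refl , C.has-y , λ (i , Bi-y) → O.lacks-y i Bi-y)

      ≤Φy : ∀ {z} → ¬ B z → z ≤Φ y
      ≤Φy ¬Bz = ¬Separable⇒≤Φ λ sep → ¬Bz (_ , O.has-i _ sep)

      y≤Φ : ∀ {z} → A z → y ≤Φ z
      y≤Φ Az = ¬Separable⇒≤Φ λ sep → C.lacks-i _ sep (Az _)

  ↓maximal-co-definable : ∀ m → Maximal _≤_ m →
    ∃ λ (k : Σ (Pred Point 0ℓ) Generated) → ∀ v → (v ≤ m → ¬ proj₁ k v) × (¬ proj₁ k v → v ≤ m)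
  ↓maximal-co-definable m max =
    (¬U _≤_ (m ≤_) , reg (lift ¬U-upset) (¬U-regular (λ xy mx → trans mx xy))) ,
    λ v → (λ vm ¬↑m → ¬↑m (m , vm , refl)) ,
          (λ ¬¬↑m → dne λ v≰m → ¬¬↑m λ (z , vz , mz) → v≰m (trans vz (max z mz)))

  module _ (SimInf⇒≡ : ∀ x y → SimInf _≤_ x y → x ≡ y) where

    separable : ∀ {x y} → ¬ x ≤ y → Separable x y
    separable x≰y = dne λ ¬sep →
      x≰y (≤Φ⇒≼ ≤Φ-lift ↓maximal-co-definable (reflexive ∘ SimInf⇒≡ _ _) (¬Separable⇒≤Φ ¬sep))

    ↑-generated : ∀ x → Generated (x ≤_)
    ↑-generated x =
      resp ((λ in-all → dne λ x≰y → C.lacks-i _ (separable x≰y) (in-all _)) ,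
            (λ xy i → Generated-upset (C.generated i) xy (C.has-y i)))
           (GenReg-⋂ size C.generated)
      where module C i = Containing (containing x i)

    upset-generated : ∀ U → UpSet _≤_ U → Generated U
    upset-generated U up =
      resp ((λ (x , Ux , xy) → up xy Ux) , (λ {y} Uy → y , Uy , refl))
           (GenReg-⋃ size ↑-if-in-U)
      where
        ↑-if-in-U : ∀ x → Generated (λ y → U x × x ≤ y)
        ↑-if-in-U x with em {P = U x}
        ... | yes Ux = resp ((Ux ,_) , proj₂) (↑-generated x)
        ... | no ¬Ux = resp ((λ ()) , ¬Ux ∘ proj₁) bot

module FiniteBoundedMeetSemilattice {c ℓ₁ ℓ₂} (em : ∀ {ℓ} → ExcludedMiddle ℓ)
  (M : BoundedMeetSemilattice c ℓ₁ ℓ₂) (n : ℕ) (enum : Fin n → BoundedMeetSemilattice.Carrier M)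
  (enum-surjective : ∀ x → ∃ λ i → BoundedMeetSemilattice._≈_ M (enum i) x) where
  open BoundedMeetSemilattice M renaming (⊤ to 𝟙)

  least-element : ∀ {ℓ} (Q : Pred Carrier ℓ) → (∀ {x y} → x ≈ y → Q x → Q y) →
                  Q 𝟙 → (∀ {x y} → Q x → Q y → Q (x ∧ y)) →
                  ∃ λ m → Q m × ∀ {x} → Q x → m ≤ x
  least-element Q Q-resp Q-𝟙 Q-∧ =
    let (m , Qm , m≤enum) = least-enumerated n enum in
    m , Qm , λ {x} Qx → let (i , eᵢ≈x) = enum-surjective x in
                        trans (m≤enum i (Q-resp (Eq.sym eᵢ≈x) Qx)) (reflexive eᵢ≈x)
    where
      least-enumerated : ∀ k (g : Fin k → Carrier) → ∃ λ m → Q m × ∀ i → Q (g i) → m ≤ g i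
      least-enumerated zero g = 𝟙 , Q-𝟙 , λ ()
      least-enumerated (suc k) g with least-enumerated k (g ∘ suc) | em {P = Q (g zero)}
      ... | m , Qm , m≤g | yes Qg₀ = g zero ∧ m , Q-∧ Qg₀ Qm ,
            λ { zero _ → x∧y≤x _ _ ; (suc i) Qgᵢ → trans (x∧y≤y _ _) (m≤g i Qgᵢ) }
      ... | m , Qm , m≤g | no ¬Qg₀ = m , Qm ,
            λ { zero Qg₀ → ⊥-elim (¬Qg₀ Qg₀) ; (suc i) → m≤g i }

module FiniteHeytingAlgebraProperties (em : ∀ {ℓ} → ExcludedMiddle ℓ)
  (H : HeytingAlgebra 0ℓ 0ℓ 0ℓ) (finite : FiniteHA H) where
  open HeytingAlgebra H renaming (⊤ to 𝟙; ⊥ to 𝟘)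
  open import Relation.Binary.Lattice.Properties.HeytingAlgebra H
    using (⇨-eval; x≤¬¬x; ⇨ˡ-contravariant; ∧-distribˡ-∨-≤)
  open import Relation.Binary.Lattice.Properties.MeetSemilattice meetSemilattice
    using (∧-monotonic)
  open import Relation.Binary.Lattice.Properties.BoundedJoinSemilattice boundedJoinSemilattice
    using (dualBoundedMeetSemilattice)

  n : ℕ
  n = proj₁ finite

  enum : Fin n → Carrier
  enum = proj₁ (proj₂ finite)

  enum-surjective : ∀ x → ∃ λ i → enum i ≈ x
  enum-surjective = proj₂ (proj₂ finite)

  open FiniteBoundedMeetSemilattice em boundedMeetSemilattice n enum enum-surjective
    using (least-element)
  open FiniteBoundedMeetSemilattice em dualBoundedMeetSemilattice n enum enum-surjective
    using () renaming (least-element to greatest-element)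

  dne : ∀ {ℓ} → DoubleNegationElimination ℓ
  dne = em⇒dne em

  Filter : Set₁
  Filter = PrimeFilter H

  _∈ᶠ_ : Carrier → Filter → Set
  a ∈ᶠ P = proj₁ P a

  _⊑ᶠ_ : Rel Filter 0ℓ
  _⊑ᶠ_ = _⊑_ H

  module F (P : Filter) = IsPrimeFilter (proj₂ P)

  ∈ᶠ-resp-≈ : ∀ P {a b} → a ≈ b → a ∈ᶠ P → b ∈ᶠ P
  ∈ᶠ-resp-≈ P = F.up P ∘ reflexive

  generator : ∀ P → ∃ λ d → d ∈ᶠ P × ∀ {a} → a ∈ᶠ P → d ≤ a
  generator P = least-element (_∈ᶠ P) (∈ᶠ-resp-≈ P) (F.top-in P) (F.∧-cl P)

  join-prime-below : ∀ {b c} → ¬ c ≤ b → ∃ λ d → d ≤ c × ¬ d ≤ b × ∀ x → ¬ d ∧ x ≤ b → d ≤ x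
  join-prime-below {b} {c} c≰b =
    let (d , d≤c , d≰b , d≤enum) = greedy n enum c c≰b in
    d , d≤c , d≰b , λ x d∧x≰b → let (i , eᵢ≈x) = enum-surjective x in
      trans (d≤enum i (d∧x≰b ∘ trans (∧-monotonic refl (reflexive (Eq.sym eᵢ≈x))))) (reflexive eᵢ≈x)
    where
      greedy : ∀ k (g : Fin k → Carrier) c → ¬ c ≤ b →
               ∃ λ d → d ≤ c × ¬ d ≤ b × ∀ i → ¬ d ∧ g i ≤ b → d ≤ g i
      greedy zero g c c≰b = c , refl , c≰b , λ ()
      greedy (suc k) g c c≰b with em {P = c ∧ g zero ≤ b}
      ... | yes c∧g₀≤b = let (d , d≤c , d≰b , d≤g) = greedy k (g ∘ suc) c c≰b in
            d , d≤c , d≰b ,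
            λ { zero d∧g₀≰b → ⊥-elim (d∧g₀≰b (trans (∧-monotonic d≤c refl) c∧g₀≤b)) ; (suc i) → d≤g i }
      ... | no c∧g₀≰b = let (d , d≤c∧g₀ , d≰b , d≤g) = greedy k (g ∘ suc) (c ∧ g zero) c∧g₀≰b in
            d , trans d≤c∧g₀ (x∧y≤x _ _) , d≰b ,
            λ { zero _ → trans d≤c∧g₀ (x∧y≤y _ _) ; (suc i) → d≤g i }

  record Extension (c b : Carrier) : Set₁ where
    field
      filter  : Filter
      has-c   : c ∈ᶠ filter
      lacks-b : ¬ b ∈ᶠ filter
      maximal : ∀ Q → filter ⊑ᶠ Q → ¬ b ∈ᶠ Q → Q ⊑ᶠ filter

  extension : ∀ {c b} → ¬ c ≤ b → Extension c b
  extension {c} {b} c≰b with join-prime-below c≰b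
  ... | d , d≤c , d≰b , d≤ = record
    { filter  = (d ≤_) , record
        { top-in = maximum d ; up = λ xy dx → trans dx xy ; ∧-cl = ∧-greatest
        ; proper = λ d≤𝟘 → d≰b (trans d≤𝟘 (minimum b)) ; prime = prime }
    ; has-c   = d≤c
    ; lacks-b = d≰b
    ; maximal = λ Q d∈Q b∉Q {x} x∈Q → dne λ d≰x →
        b∉Q (F.up Q (dne (d≰x ∘ d≤ x)) (F.∧-cl Q (d∈Q refl) x∈Q))
    }
    where
      prime : ∀ {x y} → d ≤ x ∨ y → d ≤ x ⊎ d ≤ y
      prime {x} {y} d≤x∨y with em {P = d ≤ x} | em {P = d ≤ y}
      ... | yes d≤x | _ = inj₁ d≤x
      ... | no _ | yes d≤y = inj₂ d≤y
      ... | no d≰x | no d≰y = ⊥-elim (d≰b (begin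
        d                 ≤⟨ ∧-greatest refl d≤x∨y ⟩
        d ∧ (x ∨ y)       ≤⟨ ∧-distribˡ-∨-≤ d x y ⟩
        d ∧ x ∨ d ∧ y     ≤⟨ ∨-least (dne (d≰x ∘ d≤ x)) (dne (d≰y ∘ d≤ y)) ⟩
        b                 ∎))
        where open import Relation.Binary.Reasoning.PartialOrder poset

  ⇨-counterexample : ∀ P {a b} → ¬ (a ⇨ b) ∈ᶠ P → ∃ λ R → P ⊑ᶠ R × a ∈ᶠ R × ¬ b ∈ᶠ R
  ⇨-counterexample P {a} {b} a⇨b∉P =
    let (d , d∈P , d≤) = generator P
        open Extension (extension {d ∧ a} {b} λ d∧a≤b → a⇨b∉P (F.up P (transpose-⇨ d∧a≤b) d∈P))
    in filter , (λ x∈P → F.up filter (trans (x∧y≤x _ _) (d≤ x∈P)) has-c) ,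
       F.up filter (x∧y≤y _ _) has-c , lacks-b

  ⊑ᶠ-compact : CompactPoset _⊑ᶠ_
  ⊑ᶠ-compact P =
    let (d , d∈P , d≤) = generator P
        open Extension (extension {d} {𝟘} λ d≤𝟘 → F.proper P (F.up P d≤𝟘 d∈P))
    in filter , (λ Q R⊑Q → maximal Q R⊑Q (F.proper Q)) , λ x∈P → F.up filter (d≤ x∈P) has-c

  open SimProperties _⊑ᶠ_ (λ x∈P → x∈P) (λ P⊑Q Q⊑R → Q⊑R ∘ P⊑Q)

  ∈ᶠ-∧ : ∀ {a b} → (a ∧ b) ∈ᶠ_ ≐ (a ∈ᶠ_) ∩ (b ∈ᶠ_)
  ∈ᶠ-∧ = (λ {P} a∧b∈P → F.up P (x∧y≤x _ _) a∧b∈P , F.up P (x∧y≤y _ _) a∧b∈P) ,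
         (λ {P} (a∈P , b∈P) → F.∧-cl P a∈P b∈P)

  ∈ᶠ-∨ : ∀ {a b} → (a ∨ b) ∈ᶠ_ ≐ (a ∈ᶠ_) ∪ (b ∈ᶠ_)
  ∈ᶠ-∨ = (λ {P} → F.prime P) ,
         (λ {P} → [ F.up P (x≤x∨y _ _) , F.up P (y≤x∨y _ _) ]′)

  ∈ᶠ-⇨ : ∀ {a b} → (a ⇨ b) ∈ᶠ_ ≐ (a ∈ᶠ_) ⇛ (b ∈ᶠ_)
  ∈ᶠ-⇨ = (λ {P} a⇨b∈P (Q , P⊑Q , a∈Q , b∉Q) → b∉Q (F.up Q ⇨-eval (F.∧-cl Q (P⊑Q a⇨b∈P) a∈Q))) ,
         (λ {P} no-counterexample → dne (no-counterexample ∘ ⇨-counterexample P))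

  Generated : Carrier → Set
  Generated = GenRegHA H

  ∈ᶠ-regular : ∀ {a} → a ≈ ¬H H (¬H H a) → ∁↓ (∁↓ (a ∈ᶠ_)) ⊆ (a ∈ᶠ_)
  ∈ᶠ-regular a≈¬¬a {P} ¬¬a∈P = dne λ a∉P →
    let (Q , P⊑Q , ¬a∈Q , _) = ⇨-counterexample P (a∉P ∘ ∈ᶠ-resp-≈ P (Eq.sym a≈¬¬a))
    in ¬¬a∈P (Q , P⊑Q , λ (R , Q⊑R , a∈R) →
         F.proper R (F.up R ⇨-eval (F.∧-cl R (Q⊑R ¬a∈Q) a∈R)))

  Generated⇒FinitelySaturated : ∀ {a} → Generated a → FinitelySaturated (a ∈ᶠ_)
  Generated⇒FinitelySaturated (reg {a} a≈¬¬a) =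
    regular-upset-saturated ⊑ᶠ-compact (λ P⊑Q a∈P → P⊑Q a∈P) (λ {P} → ∈ᶠ-regular a≈¬¬a {P})
  Generated⇒FinitelySaturated top = FinitelySaturated-⊤ F.top-in
  Generated⇒FinitelySaturated bot = FinitelySaturated-⊥ F.proper
  Generated⇒FinitelySaturated (meet a b) = FinitelySaturated-resp (swap ∈ᶠ-∧)
    (FinitelySaturated-∩ ⊑ᶠ-compact (Generated⇒FinitelySaturated a) (Generated⇒FinitelySaturated b))
  Generated⇒FinitelySaturated (join a b) = FinitelySaturated-resp (swap ∈ᶠ-∨)
    (FinitelySaturated-∪ ⊑ᶠ-compact (Generated⇒FinitelySaturated a) (Generated⇒FinitelySaturated b))
  Generated⇒FinitelySaturated (imp a b) = FinitelySaturated-resp (swap ∈ᶠ-⇨)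
    (FinitelySaturated-⇛ ⊑ᶠ-compact (Generated⇒FinitelySaturated a) (Generated⇒FinitelySaturated b))
  Generated⇒FinitelySaturated (resp a≈b a) =
    FinitelySaturated-resp ((λ {P} → ∈ᶠ-resp-≈ P a≈b) , (λ {P} → ∈ᶠ-resp-≈ P (Eq.sym a≈b)))
      (Generated⇒FinitelySaturated a)

  regular⇒SimInf⇒≐ : RegularHA H → ∀ P Q → SimInf _⊑ᶠ_ P Q → proj₁ P ≐ proj₁ Q
  regular⇒SimInf⇒≐ regular P Q s =
    (λ {a} → FinitelySaturated⇒SimInf-closed (Generated⇒FinitelySaturated (regular a)) s) ,
    (λ {a} → FinitelySaturated⇒SimInf-closed (Generated⇒FinitelySaturated (regular a)) (SimInf-sym s))

  least-generated-in : ∀ P →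
    ∃ λ A → (Generated A × A ∈ᶠ P) × ∀ {g} → Generated g × g ∈ᶠ P → A ≤ g
  least-generated-in P =
    least-element (λ g → Generated g × g ∈ᶠ P)
      (λ a≈b (a-gen , a∈P) → resp a≈b a-gen , ∈ᶠ-resp-≈ P a≈b a∈P)
      (top , F.top-in P)
      (λ (a-gen , a∈P) (b-gen , b∈P) → meet a-gen b-gen , F.∧-cl P a∈P b∈P)

  greatest-generated-outside : ∀ P →
    ∃ λ B → (Generated B × ¬ B ∈ᶠ P) × ∀ {g} → Generated g × ¬ g ∈ᶠ P → g ≤ B
  greatest-generated-outside P =
    greatest-element (λ g → Generated g × ¬ g ∈ᶠ P)
      (λ a≈b (a-gen , a∉P) → resp a≈b a-gen , a∉P ∘ ∈ᶠ-resp-≈ P (Eq.sym a≈b))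
      (bot , F.proper P)
      (λ (a-gen , a∉P) (b-gen , b∉P) → join a-gen b-gen , [ a∉P , b∉P ]′ ∘ F.prime P)

  greatest-generated-below : ∀ a →
    ∃ λ s → (Generated s × s ≤ a) × ∀ {g} → Generated g × g ≤ a → g ≤ s
  greatest-generated-below a =
    greatest-element (λ g → Generated g × g ≤ a)
      (λ x≈y (x-gen , x≤a) → resp x≈y x-gen , trans (reflexive (Eq.sym x≈y)) x≤a)
      (bot , minimum a)
      (λ (x-gen , x≤a) (y-gen , y≤a) → join x-gen y-gen , ∨-least x≤a y≤a)

  open Separation _⊑ᶠ_ (λ P⊑Q Q⊑R → Q⊑R ∘ P⊑Q) {I = Σ Carrier Generated}
                  (λ (g , _) P → g ∈ᶠ P) (λ _ P⊑Q → P⊑Q)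

  ≤Φ-lift : ∀ {P Q} → P ≤Φ Q → ∃ λ R → P ⊑ᶠ R × R ≈Φ Q
  ≤Φ-lift {P} {Q} P≤Φ =
    let (A , (A-gen , A∈Q) , A-least) = least-generated-in Q
        (B , (B-gen , B∉Q) , B-greatest) = greatest-generated-outside Q
        A⇨B∉P : ¬ (A ⇨ B) ∈ᶠ P
        A⇨B∉P A⇨B∈P = B∉Q (F.up Q ⇨-eval (F.∧-cl Q (P≤Φ (_ , imp A-gen B-gen) A⇨B∈P) A∈Q))
        (R , P⊑R , A∈R , B∉R) = ⇨-counterexample P A⇨B∉P
    in R , P⊑R ,
       (λ (g , g-gen) g∈R → dne λ g∉Q → B∉R (F.up R (B-greatest (g-gen , g∉Q)) g∈R)) ,
       (λ (g , g-gen) g∈Q → F.up R (A-least (g-gen , g∈Q)) A∈R)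

  ↓maximal-co-definable : ∀ M → Maximal _⊑ᶠ_ M →
    ∃ λ (k : Σ Carrier Generated) → ∀ V → (V ⊑ᶠ M → ¬ proj₁ k ∈ᶠ V) × (¬ proj₁ k ∈ᶠ V → V ⊑ᶠ M)
  ↓maximal-co-definable M max =
    let (d , d∈M , d≤) = generator M in
    (¬H H d , reg (antisym (x≤¬¬x _) (⇨ˡ-contravariant (x≤¬¬x d)))) ,
    λ V → (λ V⊑M ¬d∈V → F.proper M (F.up M ⇨-eval (F.∧-cl M (V⊑M ¬d∈V) d∈M))) ,
          (λ ¬d∉V → let (R , V⊑R , d∈R , _) = ⇨-counterexample V ¬d∉V in
                    max R (λ x∈M → F.up R (d≤ x∈M) d∈R) ∘ V⊑R)

  module _ (SimInf⇒≐ : ∀ P Q → SimInf _⊑ᶠ_ P Q → proj₁ P ≐ proj₁ Q) where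

    ≤Φ⇒⊑ : ∀ {P Q} → P ≤Φ Q → P ⊑ᶠ Q
    ≤Φ⇒⊑ {P} {Q} = ≤Φ⇒≼ (λ {P} {Q} → ≤Φ-lift {P} {Q}) ↓maximal-co-definable
                        (λ {P} {Q} s → proj₁ (SimInf⇒≐ P Q s)) {P} {Q}

    least-generated-in-generates : ∀ R {a} → a ∈ᶠ R → proj₁ (least-generated-in R) ≤ a
    least-generated-in-generates R {a} a∈R = dne λ A≰a →
      let (A , _ , A-least) = least-generated-in R
          open Extension (extension A≰a)
          R≤Φfilter : R ≤Φ filter
          R≤Φfilter (g , g-gen) g∈R = F.up filter (A-least (g-gen , g∈R)) has-c
      in lacks-b (≤Φ⇒⊑ {R} {filter} R≤Φfilter a∈R)

    all-generated : ∀ a → Generated a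
    all-generated a =
      let (s , (s-gen , s≤a) , s-greatest) = greatest-generated-below a
          a≤s : a ≤ s
          a≤s = dne λ a≰s →
            let open Extension (extension a≰s)
                (A , (A-gen , A∈R) , _) = least-generated-in filter
                A≤s = s-greatest (A-gen , least-generated-in-generates filter has-c)
            in lacks-b (F.up filter A≤s A∈R)
      in resp (antisym s≤a a≤s) s-gen

theorem3p18 : (∀ {ℓ : Level} → ExcludedMiddle ℓ) →
    ((E : EsakiaSpace) → RegularEsakia E →
      ∀ x y → SimInf (EsakiaSpace._≤_ E) x y → x ≡ y)
    × ((F : FinitePoset) →
      (∀ x y → SimInf (FinitePoset._≤_ F) x y → x ≡ y) → RegularFinitePoset F)
    × (∀ H → FiniteHA H →
      (RegularHA H → ∀ P Q → SimInf (_⊑_ H) P Q → proj₁ P ≐ proj₁ Q)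
      × ((∀ P Q → SimInf (_⊑_ H) P Q → proj₁ P ≐ proj₁ Q) → RegularHA H))
theorem3p18 em =
  EsakiaSpaceProperties.regular⇒SimInf⇒≡ em ,
  FinitePosetProperties.upset-generated em ,
  λ H finite → FiniteHeytingAlgebraProperties.regular⇒SimInf⇒≐ em H finite ,
               FiniteHeytingAlgebraProperties.all-generated em H finite
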